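{- Let $m\ge 1$ and let $\mathcal{D}$ be a quasi-symmetric SDP design, i.e. a $2$-design with parameters either $2$-$(2^{2m-1}+2^{m-1},\,2^{2m-2},\,2^{2m-2}-2^{m-1})$ or $2$-$(2^{2m-1}-2^{m-1},\,2^{2m-2}-2^{m-1},\,2^{2m-2}-2^{m-1}-1)$ such that the symmetric difference of any two distinct blocks is either a block or the complement of a block. Then for every block $B$ of $\mathcal{D}$, the residual design $\mathcal{D}_B$ is linearly embeddable over $GF(2)$.
   Context: A $2$-$(v,k,\lambda)$ design has $v$ points, blocks of size $k$, and every pair of points lies in exactly $\lambda$ blocks. For a block $B$ of a design $\mathcal{D}=(X,\mathcal{B})$, the residual design $\mathcal{D}_B$ has point set $X\setminus B$ and blocks $B_j\setminus B$ for all blocks $B_j\ne B$. $\mathcal{D}_B$ is linearly embeddable over $GF(p)$ if $\mathrm{rank}_p A=\mathrm{rank}_p A''+1$, where $A$, $A''$ are the point-by-block incidence matrices of $\mathcal{D}$ and $\mathcal{D}_B$ and $\mathrm{rank}_p$ is rank over $GF(p)$. (Such designs arise as the residual and derived designs of symmetric SDP designs.) -}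

module Defs where

open import Data.Bool using (Bool; true; false; _∧_; _xor_; not)
open import Data.Nat using (ℕ; zero; suc; _+_; _*_; _∸_; _^_; _≤_)
open import Data.Fin using (Fin; zero; suc)
open import Data.Fin.Subset using (Subset; _∈_; _⊆_; ∣_∣; ∁; ⁅_⁆; ⊤; Empty)
open import Data.Vec using (lookup; tabulate; zipWith)
open import Data.Product using (Σ; _×_; ∃)
open import Data.Sum using (_⊎_)
open import Relation.Binary.PropositionalEquality using (_≡_; _≢_)

-- GF(2) is modelled by Bool with addition _xor_ and multiplication _∧_.

⊕ : ∀ {n} → (Fin n → Bool) → Bool
⊕ {zero}  f = false
⊕ {suc n} f = f zero xor ⊕ (λ i → f (suc i))

Matrix : ℕ → ℕ → Set
Matrix r c = Fin r → Fin c → Bool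

colSum : ∀ {r c} → Matrix r c → Subset c → Fin r → Bool
colSum A T x = ⊕ (λ j → lookup T j ∧ A x j)

IndependentOn : ∀ {r c} → Matrix r c → Subset r → Subset c → Set
IndependentOn A R S =
  ∀ T → T ⊆ S → (∀ x → x ∈ R → colSum A T x ≡ false) → Empty T

IsRank₂On : ∀ {r c} → Matrix r c → Subset r → Subset c → ℕ → Set
IsRank₂On A R C n =
  (Σ _ λ S → S ⊆ C × IndependentOn A R S × ∣ S ∣ ≡ n)
  × (∀ S → S ⊆ C → IndependentOn A R S → ∣ S ∣ ≤ n)

IsRank₂ : ∀ {r c} → Matrix r c → ℕ → Set
IsRank₂ A n = IsRank₂On A ⊤ ⊤ n

Blocks : ℕ → ℕ → Set
Blocks v b = Fin b → Subset v

incidence : ∀ {v b} → Blocks v b → Matrix v b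
incidence 𝓑 x j = lookup (𝓑 j) x

blocksThrough : ∀ {v b} → Blocks v b → Fin v → Fin v → Subset b
blocksThrough 𝓑 x y = tabulate (λ j → lookup (𝓑 j) x ∧ lookup (𝓑 j) y)

Is2Design : ∀ {v b} → ℕ → ℕ → Blocks v b → Set
Is2Design {v} k lam 𝓑 =
  (∀ j → ∣ 𝓑 j ∣ ≡ k) × (∀ x y → x ≢ y → ∣ blocksThrough 𝓑 x y ∣ ≡ lam)

symDiff : ∀ {n} → Subset n → Subset n → Subset n
symDiff = zipWith _xor_

SymDiffProperty : ∀ {v b} → Blocks v b → Set
SymDiffProperty {v} {b} 𝓑 =
  ∀ i j → i ≢ j → ∃ λ l → (𝓑 l ≡ symDiff (𝓑 i) (𝓑 j)) ⊎ (𝓑 l ≡ ∁ (symDiff (𝓑 i) (𝓑 j)))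

-- SDP parameters (subtractions moved to the other side to avoid truncation):
-- 2-(2^(2m-1)+2^(m-1), 2^(2m-2), 2^(2m-2)-2^(m-1))  or
-- 2-(2^(2m-1)-2^(m-1), 2^(2m-2)-2^(m-1), 2^(2m-2)-2^(m-1)-1).
SDPParams : ℕ → ℕ → ℕ → ℕ → Set
SDPParams m v k lam =
  (v ≡ 2 ^ (2 * m ∸ 1) + 2 ^ (m ∸ 1) × k ≡ 2 ^ (2 * m ∸ 2) × lam + 2 ^ (m ∸ 1) ≡ 2 ^ (2 * m ∸ 2))
  ⊎ (v + 2 ^ (m ∸ 1) ≡ 2 ^ (2 * m ∸ 1) × k + 2 ^ (m ∸ 1) ≡ 2 ^ (2 * m ∸ 2)
     × lam + 2 ^ (m ∸ 1) + 1 ≡ 2 ^ (2 * m ∸ 2))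

-- The residual design D_B is linearly embeddable over GF(2):
-- rank_2 A = rank_2 A'' + 1.  A'' (incidence matrix of D_B: points X \ B,
-- blocks B_j \ B for j ≠ B) is exactly the submatrix of A with rows ∁ B
-- and columns ∁ {B}.
LinearlyEmbeddable₂ : ∀ {v b} → Blocks v b → Fin b → Set
LinearlyEmbeddable₂ 𝓑 B =
  ∀ r r'' → IsRank₂ (incidence 𝓑) r
          → IsRank₂On (incidence 𝓑) (∁ (𝓑 B)) (∁ ⁅ B ⁆) r''
          → r ≡ suc r''

-- Over GF(2) the column space of the incidence matrix, the binary code of the design, consists
-- of 0, the all-one word, the blocks and their complements: the symmetric difference property
-- makes this set closed under addition. As 2k < v, the only code words supported inside a block B
-- are 0 and B, i.e. restricting the code to the points outside B has kernel spanned by the column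
-- of B. Hence an independent set of columns of A, minus one column, stays independent on the
-- points outside B, while the column of B extends any independent set of the residual design.

module Submission where

open import Defs
open import Algebra.Bundles using (CommutativeRing)
open import Data.Bool using (Bool; true; false; _∧_; _xor_; not)
open import Data.Bool.Properties as Bool
  using (xor-∧-commutativeRing; xor-same; xor-identityʳ; xor-annihilates-not; ∧-distribʳ-xor)
open import Algebra.Properties.CommutativeSemigroup
  (CommutativeRing.+-commutativeSemigroup xor-∧-commutativeRing) using (interchange; xy∙z≈xz∙y)
open import Data.Empty using (⊥-elim)
open import Data.Fin using (Fin; zero; suc; _≟_)
open import Data.Fin.Properties using (all?)
open import Data.Fin.Subset
  using (Subset; _∈_; _∉_; _⊆_; ∣_∣; ∁; ⁅_⁆; ⊤; ⊥; Empty; Nonempty; _─_; _-_; _∪_)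
open import Data.Fin.Subset.Properties
  using ( x∈⁅x⁆; x∈⁅y⁆⇒x≡y; x≢y⇒x∉⁅y⁆; x∈∁p⇒x∉p; x∉p⇒x∈∁p; ∈⊤; ⊆-trans; ⊆-antisym
        ; p─q⊆p; x∈p∧x≢y⇒x∈p-y; ∪-identityʳ; p⊆p∪q; x∈p∪q⁺; x∈p∪q⁻
        ; ∣⊤∣≡n; ∣∁p∣≡n∸∣p∣; p⊆q⇒∣p∣≤∣q∣; p⊂q⇒∣p∣<∣q∣; ∣⊥∣≡0; Empty-unique
        ; _∈?_; _⊆?_; nonempty?; anySubset? )
open import Data.Nat using (ℕ; zero; suc; _+_; _*_; _∸_; _^_; _≤_; _<_; s≤s; z≤n)
open import Data.Nat.Properties
  using ( module ≤-Reasoning; ≤-refl; ≤-reflexive; ≤-trans; ≤-<-trans; ≤-antisym; <⇒≱; n≤1+n; m≤n+m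
        ; m<m+n; m+n≤o⇒m≤o∸n; +-suc; +-identityʳ; +-comm; +-cancelʳ-≡; m^n>0 )
open import Data.Nat.Tactic.RingSolver using (solve-∀)
open import Data.Product using (_×_; _,_; ∃; proj₁; proj₂)
open import Data.Sum using (_⊎_; inj₁; inj₂)
open import Data.Vec using (_∷_; lookup; there)
open import Data.Vec.Properties using (lookup-zipWith; lookup-map; lookup-replicate; []=⇒lookup; lookup⇒[]=)
open import Relation.Nullary using (yes; no)
open import Relation.Nullary.Decidable using (_×-dec_; _→-dec_)
open import Relation.Binary.PropositionalEquality

private variable n : ℕ

false≢true : false ≢ true
false≢true ()

x∉p⇒lookup≡false : ∀ {x : Fin n} {p : Subset n} → x ∉ p → lookup p x ≡ false
x∉p⇒lookup≡false {x = x} {p} x∉p with lookup p x in px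
... | true  = ⊥-elim (x∉p (lookup⇒[]= x p px))
... | false = refl

lookup≡false⇒x∉p : ∀ {x : Fin n} {p : Subset n} → lookup p x ≡ false → x ∉ p
lookup≡false⇒x∉p px≡false x∈p with () ← trans (sym ([]=⇒lookup x∈p)) px≡false

x∈p─q⇒x∉q : ∀ {x : Fin n} (p q : Subset n) → x ∈ p ─ q → x ∉ q
x∈p─q⇒x∉q (_ ∷ p) (true  ∷ q) (there x∈p─q) (there x∈q) = x∈p─q⇒x∉q p q x∈p─q x∈q
x∈p─q⇒x∉q (_ ∷ p) (false ∷ q) (there x∈p─q) (there x∈q) = x∈p─q⇒x∉q p q x∈p─q x∈q

x∉p-x : ∀ (p : Subset n) x → x ∉ p - x
x∉p-x p x x∈p-x = x∈p─q⇒x∉q p ⁅ x ⁆ x∈p-x (x∈⁅x⁆ x)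

p-x⊆∁⁅x⁆ : ∀ (p : Subset n) x → p - x ⊆ ∁ ⁅ x ⁆
p-x⊆∁⁅x⁆ p x y∈p-x = x∉p⇒x∈∁p (x∈p─q⇒x∉q p ⁅ x ⁆ y∈p-x)

x∉p⇒p⊆∁⁅x⁆ : ∀ {x : Fin n} {p : Subset n} → x ∉ p → p ⊆ ∁ ⁅ x ⁆
x∉p⇒p⊆∁⁅x⁆ x∉p y∈p = x∉p⇒x∈∁p (x≢y⇒x∉⁅y⁆ λ { refl → x∉p y∈p })

∣p∪⁅x⁆∣≤1+∣p∣ : ∀ (p : Subset n) x → ∣ p ∪ ⁅ x ⁆ ∣ ≤ suc ∣ p ∣
∣p∪⁅x⁆∣≤1+∣p∣ (true  ∷ p) zero    rewrite ∪-identityʳ p = n≤1+n _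
∣p∪⁅x⁆∣≤1+∣p∣ (false ∷ p) zero    rewrite ∪-identityʳ p = ≤-refl
∣p∪⁅x⁆∣≤1+∣p∣ (true  ∷ p) (suc x) = s≤s (∣p∪⁅x⁆∣≤1+∣p∣ p x)
∣p∪⁅x⁆∣≤1+∣p∣ (false ∷ p) (suc x) = ∣p∪⁅x⁆∣≤1+∣p∣ p x

∣p∣≤1+∣p-x∣ : ∀ (p : Subset n) x → ∣ p ∣ ≤ suc ∣ p - x ∣
∣p∣≤1+∣p-x∣ p x = ≤-trans (p⊆q⇒∣p∣≤∣q∣ p⊆[p-x]∪⁅x⁆) (∣p∪⁅x⁆∣≤1+∣p∣ (p - x) x)
  where
  p⊆[p-x]∪⁅x⁆ : p ⊆ (p - x) ∪ ⁅ x ⁆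
  p⊆[p-x]∪⁅x⁆ {y} y∈p with y ≟ x
  ... | yes refl = x∈p∪q⁺ (inj₂ (x∈⁅x⁆ x))
  ... | no y≢x   = x∈p∪q⁺ (inj₁ (x∈p∧x≢y⇒x∈p-y y∈p y≢x))

x∉p⇒∣p∣<∣p∪⁅x⁆∣ : ∀ {x : Fin n} {p : Subset n} → x ∉ p → ∣ p ∣ < ∣ p ∪ ⁅ x ⁆ ∣
x∉p⇒∣p∣<∣p∪⁅x⁆∣ {x = x} x∉p = p⊂q⇒∣p∣<∣q∣ (p⊆p∪q ⁅ x ⁆ , x , x∈p∪q⁺ (inj₂ (x∈⁅x⁆ x)) , x∉p)

p⊆q∧∣q∣≤∣p∣⇒p≡q : ∀ {p q : Subset n} → p ⊆ q → ∣ q ∣ ≤ ∣ p ∣ → p ≡ q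
p⊆q∧∣q∣≤∣p∣⇒p≡q {p = p} {q} p⊆q ∣q∣≤∣p∣ = ⊆-antisym p⊆q q⊆p
  where
  q⊆p : q ⊆ p
  q⊆p {x} x∈q with x ∈? p
  ... | yes x∈p = x∈p
  ... | no  x∉p = ⊥-elim (<⇒≱ (p⊂q⇒∣p∣<∣q∣ (p⊆q , x , x∈q , x∉p)) ∣q∣≤∣p∣)

0<∣p∣⇒nonempty : ∀ {p : Subset n} → 0 < ∣ p ∣ → Nonempty p
0<∣p∣⇒nonempty {n} {p} 0<∣p∣ with nonempty? p
... | yes p-nonempty = p-nonempty
... | no  p-empty    = ⊥-elim (<⇒≱ 0<∣p∣ (≤-reflexive (trans (cong ∣_∣ (Empty-unique p-empty)) (∣⊥∣≡0 n))))

indicator-vanishes-off⇒⊆ : ∀ {f : Fin n → Bool} (P : Subset n) {Q}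
  → (∀ x → f x ≡ lookup P x) → (∀ x → x ∈ ∁ Q → f x ≡ false) → P ⊆ Q
indicator-vanishes-off⇒⊆ {f = f} P {Q} f≈P f-vanishes {x} x∈P with x ∈? Q
... | yes x∈Q = x∈Q
... | no  x∉Q = ⊥-elim (false≢true (begin
  false       ≡⟨ f-vanishes x (x∉p⇒x∈∁p x∉Q) ⟨
  f x         ≡⟨ f≈P x ⟩
  lookup P x  ≡⟨ []=⇒lookup x∈P ⟩
  true        ∎))
  where open ≡-Reasoning

lookup-symDiff : ∀ (p q : Subset n) x → lookup (symDiff p q) x ≡ lookup p x xor lookup q x
lookup-symDiff p q x = lookup-zipWith _xor_ x p q

x∈symDiff⁻ : ∀ {x : Fin n} (p q : Subset n) → x ∈ symDiff p q → x ∈ p × x ∉ q ⊎ x ∉ p × x ∈ q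
x∈symDiff⁻ {x = x} p q x∈ with lookup p x in px | lookup q x in qx
                             | trans (sym (lookup-symDiff p q x)) ([]=⇒lookup x∈)
... | true  | false | _ = inj₁ (lookup⇒[]= x p px , lookup≡false⇒x∉p qx)
... | false | true  | _ = inj₂ (lookup≡false⇒x∉p px , lookup⇒[]= x q qx)

x∉p⇒x∈q⇒x∈symDiff : ∀ {x : Fin n} {p q : Subset n} → x ∉ p → x ∈ q → x ∈ symDiff p q
x∉p⇒x∈q⇒x∈symDiff {x = x} {p} {q} x∉p x∈q = lookup⇒[]= x (symDiff p q) (begin
  lookup (symDiff p q) x      ≡⟨ lookup-symDiff p q x ⟩
  lookup p x xor lookup q x   ≡⟨ cong₂ _xor_ (x∉p⇒lookup≡false x∉p) ([]=⇒lookup x∈q) ⟩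
  true                        ∎)
  where open ≡-Reasoning

-- Column sums and independence over GF(2)

⊕-cong : ∀ {f g : Fin n → Bool} → (∀ i → f i ≡ g i) → ⊕ f ≡ ⊕ g
⊕-cong {zero}  f≗g = refl
⊕-cong {suc n} f≗g = cong₂ _xor_ (f≗g zero) (⊕-cong (λ i → f≗g (suc i)))

⊕-distrib-xor : ∀ (f g : Fin n → Bool) → ⊕ (λ i → f i xor g i) ≡ ⊕ f xor ⊕ g
⊕-distrib-xor {zero}  f g = refl
⊕-distrib-xor {suc n} f g = trans
  (cong ((f zero xor g zero) xor_) (⊕-distrib-xor (λ i → f (suc i)) (λ i → g (suc i))))
  (interchange (f zero) (g zero) _ _)

colSum-⊥ : ∀ {r c} (A : Matrix r c) x → colSum A ⊥ x ≡ false
colSum-⊥ {c = zero}  A x = refl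
colSum-⊥ {c = suc c} A x = colSum-⊥ (λ y j → A y (suc j)) x

colSum-Empty : ∀ {r c} (A : Matrix r c) {T} → Empty T → ∀ x → colSum A T x ≡ false
colSum-Empty A T-empty x rewrite Empty-unique T-empty = colSum-⊥ A x

colSum-⁅⁆ : ∀ {r c} (A : Matrix r c) j x → colSum A ⁅ j ⁆ x ≡ A x j
colSum-⁅⁆ A zero    x =
  trans (cong (A x zero xor_) (colSum-⊥ (λ y j → A y (suc j)) x)) (xor-identityʳ (A x zero))
colSum-⁅⁆ A (suc j) x = colSum-⁅⁆ (λ y i → A y (suc i)) j x

module _ {r c} (A : Matrix r c) where

  SumsToZeroOn : Subset r → Subset c → Set
  SumsToZeroOn R T = ∀ x → x ∈ R → colSum A T x ≡ false

  KernelOfRestriction : Subset r → Fin c → Set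
  KernelOfRestriction R B =
    ∀ T → SumsToZeroOn R T → (∀ x → colSum A T x ≡ false) ⊎ (∀ x → colSum A T x ≡ A x B)

  colSum-symDiff : ∀ T U x → colSum A (symDiff T U) x ≡ colSum A T x xor colSum A U x
  colSum-symDiff T U x = trans
    (⊕-cong λ j → trans (cong (_∧ A x j) (lookup-symDiff T U j))
                        (∧-distribʳ-xor (A x j) (lookup T j) (lookup U j)))
    (⊕-distrib-xor (λ j → lookup T j ∧ A x j) (λ j → lookup U j ∧ A x j))

  independent⊎dependent : ∀ R S →
    IndependentOn A R S ⊎ ∃ λ T → T ⊆ S × Nonempty T × SumsToZeroOn R T
  independent⊎dependent R S with anySubset? dependent?
    where
    dependent? = λ T → (T ⊆? S) ×-dec nonempty? T
                  ×-dec all? (λ x → (x ∈? R) →-dec (colSum A T x Bool.≟ false))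
  ... | yes dependent = inj₂ dependent
  ... | no  ¬dependent = inj₁ λ T T⊆S T-sums-to-0 T-nonempty → ¬dependent (T , T⊆S , T-nonempty , T-sums-to-0)

  independent⇒colSum-injective : ∀ {R S U T} → IndependentOn A R S → U ⊆ S → T ⊆ S
    → (∀ x → x ∈ R → colSum A U x ≡ colSum A T x) → U ≡ T
  independent⇒colSum-injective {R} {S} {U} {T} independent U⊆S T⊆S U≈T =
    ⊆-antisym (⊆-of-equal-sums T⊆S U⊆S (λ x x∈R → sym (U≈T x x∈R))) (⊆-of-equal-sums U⊆S T⊆S U≈T)
    where
    ⊆-of-equal-sums : ∀ {U T} → U ⊆ S → T ⊆ S → (∀ x → x ∈ R → colSum A U x ≡ colSum A T x) → T ⊆ U
    ⊆-of-equal-sums {U} {T} U⊆S T⊆S U≈T {t} t∈T with t ∈? U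
    ... | yes t∈U = t∈U
    ... | no  t∉U = ⊥-elim (independent (symDiff U T) U△T⊆S U△T-sums-to-0 (t , x∉p⇒x∈q⇒x∈symDiff t∉U t∈T))
      where
      U△T⊆S : symDiff U T ⊆ S
      U△T⊆S i∈ with x∈symDiff⁻ U T i∈
      ... | inj₁ (i∈U , _) = U⊆S i∈U
      ... | inj₂ (_ , i∈T) = T⊆S i∈T
      U△T-sums-to-0 : SumsToZeroOn R (symDiff U T)
      U△T-sums-to-0 x x∈R = begin
        colSum A (symDiff U T) x       ≡⟨ colSum-symDiff U T x ⟩
        colSum A U x xor colSum A T x  ≡⟨ cong (_xor colSum A T x) (U≈T x x∈R) ⟩
        colSum A T x xor colSum A T x  ≡⟨ xor-same (colSum A T x) ⟩
        false                          ∎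
        where open ≡-Reasoning

  -- On R column B vanishes, so a dependency among S ∪ {B} restricts to one among S; and B is nonzero.
  extend-independent : ∀ {R S B} → (∀ x → x ∈ R → A x B ≡ false) → (∃ λ x → A x B ≡ true)
    → B ∉ S → IndependentOn A R S → IndependentOn A ⊤ (S ∪ ⁅ B ⁆)
  extend-independent {S = S} {B} B-vanishes-on-R (x₀ , B-nonzero-at-x₀) B∉S independent T T⊆S∪B T-sums-to-0
    with B ∈? T
  ... | no B∉T = independent T T⊆S (λ x _ → T-sums-to-0 x ∈⊤)
    where
    T⊆S : T ⊆ S
    T⊆S i∈T with x∈p∪q⁻ S ⁅ B ⁆ (T⊆S∪B i∈T)
    ... | inj₁ i∈S = i∈S
    ... | inj₂ i∈B rewrite x∈⁅y⁆⇒x≡y B i∈B = ⊥-elim (B∉T i∈T)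
  ... | yes B∈T = λ _ → false≢true (trans (sym (colSum-Empty A T△B-empty x₀)) T△B-at-x₀)
    where
    colSum-T△B : ∀ x → colSum A (symDiff T ⁅ B ⁆) x ≡ colSum A T x xor A x B
    colSum-T△B x = trans (colSum-symDiff T ⁅ B ⁆ x) (cong (colSum A T x xor_) (colSum-⁅⁆ A B x))
    T△B⊆S : symDiff T ⁅ B ⁆ ⊆ S
    T△B⊆S i∈ with x∈symDiff⁻ T ⁅ B ⁆ i∈
    ... | inj₂ (i∉T , i∈B) rewrite x∈⁅y⁆⇒x≡y B i∈B = ⊥-elim (i∉T B∈T)
    ... | inj₁ (i∈T , i∉B) with x∈p∪q⁻ S ⁅ B ⁆ (T⊆S∪B i∈T)
    ...   | inj₁ i∈S = i∈S
    ...   | inj₂ i∈B = ⊥-elim (i∉B i∈B)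
    T△B-empty : Empty (symDiff T ⁅ B ⁆)
    T△B-empty = independent _ T△B⊆S λ x x∈R →
      trans (colSum-T△B x) (cong₂ _xor_ (T-sums-to-0 x ∈⊤) (B-vanishes-on-R x x∈R))
    T△B-at-x₀ : colSum A (symDiff T ⁅ B ⁆) x₀ ≡ true
    T△B-at-x₀ = trans (colSum-T△B x₀) (cong₂ _xor_ (T-sums-to-0 x₀ ∈⊤) B-nonzero-at-x₀)

  -- Either S - B stays independent on R, or some T ⊆ S - B sums to column B; then B ∉ S, and T is
  -- the only such subset of S, so removing any t ∈ T from S restores independence on R.
  restrict-independent : ∀ {R S B} → KernelOfRestriction R B → IndependentOn A ⊤ S
    → ∃ λ S′ → S′ ⊆ ∁ ⁅ B ⁆ × IndependentOn A R S′ × ∣ S ∣ ≤ suc ∣ S′ ∣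
  restrict-independent {R} {S} {B} kernel independent with independent⊎dependent R (S - B)
  ... | inj₁ S-B-independent = S - B , p-x⊆∁⁅x⁆ S B , S-B-independent , ∣p∣≤1+∣p-x∣ S B
  ... | inj₂ (T , T⊆S-B , (t , t∈T) , T-sums-to-0) =
    S - t , ⊆-trans S-t⊆S (x∉p⇒p⊆∁⁅x⁆ B∉S) , S-t-independent , ∣p∣≤1+∣p-x∣ S t
    where
    T⊆S : T ⊆ S
    T⊆S = ⊆-trans T⊆S-B (p─q⊆p S ⁅ B ⁆)
    S-t⊆S : S - t ⊆ S
    S-t⊆S = p─q⊆p S ⁅ t ⁆
    T≈B : ∀ x → colSum A T x ≡ A x B
    T≈B with kernel T T-sums-to-0
    ... | inj₁ T≈0 = ⊥-elim (independent T T⊆S (λ x _ → T≈0 x) (t , t∈T))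
    ... | inj₂ T≈B = T≈B
    B∉S : B ∉ S
    B∉S B∈S = x∉p-x S B (T⊆S-B (subst (B ∈_) ⁅B⁆≡T (x∈⁅x⁆ B)))
      where
      ⁅B⁆⊆S : ⁅ B ⁆ ⊆ S
      ⁅B⁆⊆S i∈⁅B⁆ rewrite x∈⁅y⁆⇒x≡y B i∈⁅B⁆ = B∈S
      ⁅B⁆≡T : ⁅ B ⁆ ≡ T
      ⁅B⁆≡T = independent⇒colSum-injective independent ⁅B⁆⊆S T⊆S
                (λ x _ → trans (colSum-⁅⁆ A B x) (sym (T≈B x)))
    S-t-independent : IndependentOn A R (S - t)
    S-t-independent U U⊆S-t U-sums-to-0 (u , u∈U) with kernel U U-sums-to-0
    ... | inj₁ U≈0 = independent U (⊆-trans U⊆S-t S-t⊆S) (λ x _ → U≈0 x) (u , u∈U)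
    ... | inj₂ U≈B = x∉p-x S t (U⊆S-t (subst (t ∈_) (sym U≡T) t∈T))
      where
      U≡T : U ≡ T
      U≡T = independent⇒colSum-injective independent (⊆-trans U⊆S-t S-t⊆S) T⊆S
              (λ x _ → trans (U≈B x) (sym (T≈B x)))

  rank-drop-column : ∀ {R B} → (∀ x → x ∈ R → A x B ≡ false) → (∃ λ x → A x B ≡ true)
    → KernelOfRestriction R B → ∀ r r″ → IsRank₂ A r → IsRank₂On A R (∁ ⁅ B ⁆) r″ → r ≡ suc r″
  rank-drop-column {B = B} B-vanishes-on-R B-nonzero kernel r r″
    ((S , _ , S-independent , ∣S∣≡r) , r-maximal) ((S″ , S″⊆∁B , S″-independent , ∣S″∣≡r″) , r″-maximal) =
    ≤-antisym r≤1+r″ 1+r″≤r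
    where
    open ≤-Reasoning
    r≤1+r″ : r ≤ suc r″
    r≤1+r″ with restrict-independent kernel S-independent
    ... | S′ , S′⊆∁B , S′-independent , ∣S∣≤1+∣S′∣ = begin
      r          ≡⟨ ∣S∣≡r ⟨
      ∣ S ∣      ≤⟨ ∣S∣≤1+∣S′∣ ⟩
      suc ∣ S′ ∣ ≤⟨ s≤s (r″-maximal S′ S′⊆∁B S′-independent) ⟩
      suc r″     ∎
    B∉S″ : B ∉ S″
    B∉S″ B∈S″ = x∈∁p⇒x∉p (S″⊆∁B B∈S″) (x∈⁅x⁆ B)
    S″∪B-independent : IndependentOn A ⊤ (S″ ∪ ⁅ B ⁆)
    S″∪B-independent = extend-independent B-vanishes-on-R B-nonzero B∉S″ S″-independent
    1+r″≤r : suc r″ ≤ r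
    1+r″≤r = begin-strict
      r″               ≡⟨ ∣S″∣≡r″ ⟨
      ∣ S″ ∣           <⟨ x∉p⇒∣p∣<∣p∪⁅x⁆∣ B∉S″ ⟩
      ∣ S″ ∪ ⁅ B ⁆ ∣   ≤⟨ r-maximal _ (λ _ → ∈⊤) S″∪B-independent ⟩
      r                ∎

-- The binary code of an SDP design

module _ {v b} (𝓑 : Blocks v b) where

  𝓑[_] : Fin b → Fin v → Bool
  𝓑[ l ] x = lookup (𝓑 l) x

  -- 0, 1, a block, or the complement of a block.
  data CodeWord (f : Fin v → Bool) : Set where
    constant : ∀ c → (∀ x → f x ≡ c) → CodeWord f
    block    : ∀ c l → (∀ x → f x ≡ c xor 𝓑[ l ] x) → CodeWord f

  codeWord-xor : SymDiffProperty 𝓑 → ∀ {f g} → CodeWord f → CodeWord g → CodeWord (λ x → f x xor g x)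
  codeWord-xor _ (constant c f≈) (constant d g≈) = constant (c xor d) λ x → cong₂ _xor_ (f≈ x) (g≈ x)
  codeWord-xor _ (constant c f≈) (block d l g≈) =
    block (c xor d) l λ x → trans (cong₂ _xor_ (f≈ x) (g≈ x)) (sym (Bool.xor-assoc c d _))
  codeWord-xor _ (block c l f≈) (constant d g≈) =
    block (c xor d) l λ x → trans (cong₂ _xor_ (f≈ x) (g≈ x)) (xy∙z≈xz∙y c _ d)
  codeWord-xor sdp {f} {g} (block c i f≈) (block d j g≈) with i ≟ j
  ... | yes refl = constant (c xor d) λ x → begin
    f x xor g x                                 ≡⟨ cong₂ _xor_ (f≈ x) (g≈ x) ⟩
    (c xor 𝓑[ i ] x) xor (d xor 𝓑[ j ] x)       ≡⟨ interchange c _ d _ ⟩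
    (c xor d) xor (𝓑[ i ] x xor 𝓑[ i ] x)       ≡⟨ cong ((c xor d) xor_) (xor-same (𝓑[ i ] x)) ⟩
    (c xor d) xor false                         ≡⟨ xor-identityʳ (c xor d) ⟩
    c xor d                                     ∎
    where open ≡-Reasoning
  ... | no i≢j with sdp i j i≢j
  ...   | l , inj₁ 𝓑l≡i△j = block (c xor d) l λ x → begin
    f x xor g x                                 ≡⟨ cong₂ _xor_ (f≈ x) (g≈ x) ⟩
    (c xor 𝓑[ i ] x) xor (d xor 𝓑[ j ] x)       ≡⟨ interchange c _ d _ ⟩
    (c xor d) xor (𝓑[ i ] x xor 𝓑[ j ] x)       ≡⟨ cong ((c xor d) xor_) (lookup-symDiff (𝓑 i) (𝓑 j) x) ⟨
    (c xor d) xor lookup (symDiff (𝓑 i) (𝓑 j)) x ≡⟨ cong (λ p → (c xor d) xor lookup p x) 𝓑l≡i△j ⟨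
    (c xor d) xor 𝓑[ l ] x                      ∎
    where open ≡-Reasoning
  ...   | l , inj₂ 𝓑l≡∁i△j = block (not (c xor d)) l λ x → begin
    f x xor g x                                 ≡⟨ cong₂ _xor_ (f≈ x) (g≈ x) ⟩
    (c xor 𝓑[ i ] x) xor (d xor 𝓑[ j ] x)       ≡⟨ interchange c _ d _ ⟩
    (c xor d) xor (𝓑[ i ] x xor 𝓑[ j ] x)       ≡⟨ xor-annihilates-not (c xor d) _ ⟨
    not (c xor d) xor not (𝓑[ i ] x xor 𝓑[ j ] x)
      ≡⟨ cong (λ y → not (c xor d) xor not y) (lookup-symDiff (𝓑 i) (𝓑 j) x) ⟨
    not (c xor d) xor not (lookup (symDiff (𝓑 i) (𝓑 j)) x)
      ≡⟨ cong (not (c xor d) xor_) (lookup-map x not (symDiff (𝓑 i) (𝓑 j))) ⟨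
    not (c xor d) xor lookup (∁ (symDiff (𝓑 i) (𝓑 j))) x
      ≡⟨ cong (λ p → not (c xor d) xor lookup p x) 𝓑l≡∁i△j ⟨
    not (c xor d) xor 𝓑[ l ] x                  ∎
    where open ≡-Reasoning

  codeWord-⊕ : SymDiffProperty 𝓑 → ∀ {n} (F : Fin n → Fin v → Bool)
    → (∀ j → CodeWord (F j)) → CodeWord (λ x → ⊕ (λ j → F j x))
  codeWord-⊕ sdp {zero}  F F-codeWords = constant false λ _ → refl
  codeWord-⊕ sdp {suc n} F F-codeWords =
    codeWord-xor sdp (F-codeWords zero) (codeWord-⊕ sdp (λ j → F (suc j)) (λ j → F-codeWords (suc j)))

  codeWord-colSum : SymDiffProperty 𝓑 → ∀ T → CodeWord (colSum (incidence 𝓑) T)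
  codeWord-colSum sdp T = codeWord-⊕ sdp (λ j x → lookup T j ∧ 𝓑[ j ] x) term
    where
    term : ∀ j → CodeWord (λ x → lookup T j ∧ 𝓑[ j ] x)
    term j with lookup T j
    ... | true  = block false j λ _ → refl
    ... | false = constant false λ _ → refl

  ⊆-block⇒∣∣≤k : ∀ {k P B} → (∀ j → ∣ 𝓑 j ∣ ≡ k) → P ⊆ 𝓑 B → ∣ P ∣ ≤ k
  ⊆-block⇒∣∣≤k {B = B} ∣𝓑∣≡k P⊆B = ≤-trans (p⊆q⇒∣p∣≤∣q∣ P⊆B) (≤-reflexive (∣𝓑∣≡k B))

  -- 1 and the complements of blocks have more than k points, and a block inside B is B.
  codeWord-inside-block : ∀ {k} → (∀ j → ∣ 𝓑 j ∣ ≡ k) → k + k < v → ∀ {f} B → CodeWord f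
    → (∀ x → x ∈ ∁ (𝓑 B) → f x ≡ false) → (∀ x → f x ≡ false) ⊎ (∀ x → f x ≡ 𝓑[ B ] x)
  codeWord-inside-block ∣𝓑∣≡k 2k<v B (constant false f≈0) f⊆B = inj₁ f≈0
  codeWord-inside-block {k} ∣𝓑∣≡k 2k<v B (constant true f≈1) f⊆B = ⊥-elim (<⇒≱ k<∣⊤∣ ∣⊤∣≤k)
    where
    ∣⊤∣≤k : ∣ ⊤ {v} ∣ ≤ k
    ∣⊤∣≤k = ⊆-block⇒∣∣≤k ∣𝓑∣≡k
      (indicator-vanishes-off⇒⊆ ⊤ (λ x → trans (f≈1 x) (sym (lookup-replicate x true))) f⊆B)
    k<∣⊤∣ : k < ∣ ⊤ {v} ∣
    k<∣⊤∣ rewrite ∣⊤∣≡n v = ≤-<-trans (m≤n+m k k) 2k<v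
  codeWord-inside-block {k} ∣𝓑∣≡k 2k<v B (block true l f≈∁l) f⊆B = ⊥-elim (<⇒≱ k<∣∁l∣ ∣∁l∣≤k)
    where
    ∣∁l∣≤k : ∣ ∁ (𝓑 l) ∣ ≤ k
    ∣∁l∣≤k = ⊆-block⇒∣∣≤k ∣𝓑∣≡k
      (indicator-vanishes-off⇒⊆ (∁ (𝓑 l)) (λ x → trans (f≈∁l x) (sym (lookup-map x not (𝓑 l)))) f⊆B)
    k<∣∁l∣ : k < ∣ ∁ (𝓑 l) ∣
    k<∣∁l∣ rewrite ∣∁p∣≡n∸∣p∣ (𝓑 l) | ∣𝓑∣≡k l = m+n≤o⇒m≤o∸n (suc k) 2k<v
  codeWord-inside-block ∣𝓑∣≡k 2k<v B (block false l f≈l) f⊆B =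
    inj₂ λ x → trans (f≈l x) (cong (λ p → lookup p x) 𝓑l≡𝓑B)
    where
    𝓑l≡𝓑B : 𝓑 l ≡ 𝓑 B
    𝓑l≡𝓑B = p⊆q∧∣q∣≤∣p∣⇒p≡q (indicator-vanishes-off⇒⊆ (𝓑 l) f≈l f⊆B)
              (≤-reflexive (trans (∣𝓑∣≡k B) (sym (∣𝓑∣≡k l))))

-- Arithmetic of the SDP parameters

2^[2m∸1]≡2^[2m∸2]+2^[2m∸2] : ∀ m → 1 ≤ m → 2 ^ (2 * m ∸ 1) ≡ 2 ^ (2 * m ∸ 2) + 2 ^ (2 * m ∸ 2)
2^[2m∸1]≡2^[2m∸2]+2^[2m∸2] (suc m) _ rewrite +-suc m (m + 0) = cong (2 ^ (m + (m + 0)) +_) (+-identityʳ _)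

sdp-bounds : ∀ {m v k lam} → 1 ≤ m → SDPParams m v k lam → 1 ≤ k × k + k < v
sdp-bounds {m} 1≤m (inj₁ (refl , refl , _)) = m^n>0 2 (2 * m ∸ 2) , (begin-strict
  K + K                <⟨ m<m+n (K + K) (m^n>0 2 (m ∸ 1)) ⟩
  K + K + P            ≡⟨ cong (_+ P) (2^[2m∸1]≡2^[2m∸2]+2^[2m∸2] m 1≤m) ⟨
  2 ^ (2 * m ∸ 1) + P  ∎)
  where
  open ≤-Reasoning
  K = 2 ^ (2 * m ∸ 2)
  P = 2 ^ (m ∸ 1)
sdp-bounds {m} {v} {k} {lam} 1≤m (inj₂ (v+P≡2^[2m∸1] , k+P≡K , lam+P+1≡K)) = 1≤k , k+k<v
  where
  K = 2 ^ (2 * m ∸ 2)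
  P = 2 ^ (m ∸ 1)
  k≡1+lam : k ≡ suc lam
  k≡1+lam = +-cancelʳ-≡ P k (suc lam) (trans k+P≡K (trans (sym lam+P+1≡K) (+-comm (lam + P) 1)))
  1≤k : 1 ≤ k
  1≤k rewrite k≡1+lam = s≤s z≤n
  rearrange : ∀ k P → (k + P) + (k + P) ≡ (k + k + P) + P
  rearrange = solve-∀
  v≡k+k+P : v ≡ k + k + P
  v≡k+k+P = +-cancelʳ-≡ P v (k + k + P) (begin
    v + P                ≡⟨ v+P≡2^[2m∸1] ⟩
    2 ^ (2 * m ∸ 1)      ≡⟨ 2^[2m∸1]≡2^[2m∸2]+2^[2m∸2] m 1≤m ⟩
    K + K                ≡⟨ cong₂ _+_ k+P≡K k+P≡K ⟨
    (k + P) + (k + P)    ≡⟨ rearrange k P ⟩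
    (k + k + P) + P      ∎)
    where open ≡-Reasoning
  k+k<v : k + k < v
  k+k<v rewrite v≡k+k+P = m<m+n (k + k) (m^n>0 2 (m ∸ 1))

theorem2p5 : (m v k lam b : ℕ) (𝓑 : Blocks v b)
    → 1 ≤ m
    → SDPParams m v k lam
    → Is2Design k lam 𝓑
    → SymDiffProperty 𝓑
    → (B : Fin b) → LinearlyEmbeddable₂ 𝓑 B
theorem2p5 m v k lam b 𝓑 1≤m params (∣𝓑∣≡k , _) sdp B =
  rank-drop-column (incidence 𝓑) B-vanishes-off-B B-nonzero kernel
  where
  bounds : 1 ≤ k × k + k < v
  bounds = sdp-bounds 1≤m params
  B-vanishes-off-B : ∀ x → x ∈ ∁ (𝓑 B) → lookup (𝓑 B) x ≡ false
  B-vanishes-off-B x x∈∁B = x∉p⇒lookup≡false (x∈∁p⇒x∉p x∈∁B)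
  B-nonzero : ∃ λ x → lookup (𝓑 B) x ≡ true
  B-nonzero with 0<∣p∣⇒nonempty {p = 𝓑 B} (subst (0 <_) (sym (∣𝓑∣≡k B)) (proj₁ bounds))
  ... | x , x∈B = x , []=⇒lookup x∈B
  kernel : KernelOfRestriction (incidence 𝓑) (∁ (𝓑 B)) B
  kernel T T-vanishes = codeWord-inside-block 𝓑 ∣𝓑∣≡k (proj₂ bounds) B (codeWord-colSum 𝓑 sdp T) T-vanishes
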